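{- The class $\mathcal S$ of all SMB algebras (of arbitrary cardinality) is a variety, i.e. it is closed under homomorphic images, subalgebras and direct products.
   Context: An algebra $\mathbf A=(A;\wedge,d)$ with a binary operation $\wedge$ and a ternary operation $d$ is idempotent if $x\wedge x=x$ and $d(x,x,x)=x$ for all $x\in A$. For a congruence ${\sim}$ of $\mathbf A$, $\mathbf A$ is an SMB algebra over ${\sim}$ if $\mathbf A$ is idempotent and: (i) $(A/{\sim};\wedge^{\mathbf A/{\sim}})$ is a semilattice; (ii) on each ${\sim}$-class $D$ (a subuniverse, by idempotence), $\wedge$ restricted to $D$ is the second projection ($x\wedge y=y$ for $x,y\in D$) and $d$ restricted to $D$ is a Mal'cev operation ($d(x,y,y)=x=d(y,y,x)$ for $x,y\in D$). $\mathbf A$ is an SMB algebra if it is an SMB algebra over some congruence of $\mathbf A$. -}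

module Defs where

open import Level using (Level; _⊔_; suc)
open import Data.Product using (Σ; _×_; _,_; proj₁; ∃)
open import Relation.Binary.Core using (Rel)
open import Relation.Binary.Structures using (IsEquivalence)

-- Algebras of signature (∧ binary, d ternary), over a setoid carrier
-- (equality _≈_; needed since products would otherwise require funext).
record Algebra (c ℓ : Level) : Set (suc (c ⊔ ℓ)) where
  infixr 7 _∧_
  infix 4 _≈_
  field
    Carrier       : Set c
    _≈_           : Rel Carrier ℓ
    isEquivalence : IsEquivalence _≈_
    _∧_           : Carrier → Carrier → Carrier
    d             : Carrier → Carrier → Carrier → Carrier
    ∧-cong        : ∀ {x x′ y y′} → x ≈ x′ → y ≈ y′ → (x ∧ y) ≈ (x′ ∧ y′)
    d-cong        : ∀ {x x′ y y′ z z′} → x ≈ x′ → y ≈ y′ → z ≈ z′ → d x y z ≈ d x′ y′ z′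

module _ {c ℓ : Level} (A : Algebra c ℓ) where
  open Algebra A

  record Congruence : Set (suc (c ⊔ ℓ)) where
    infix 4 _∼_
    field
      _∼_           : Rel Carrier ℓ
      isEquivalence : IsEquivalence _∼_
      ≈⇒∼           : ∀ {x y} → x ≈ y → x ∼ y
      ∧-compat      : ∀ {x x′ y y′} → x ∼ x′ → y ∼ y′ → (x ∧ y) ∼ (x′ ∧ y′)
      d-compat      : ∀ {x x′ y y′ z z′} → x ∼ x′ → y ∼ y′ → z ∼ z′ → d x y z ∼ d x′ y′ z′

  IsIdempotent : Set (c ⊔ ℓ)
  IsIdempotent = (∀ x → (x ∧ x) ≈ x) × (∀ x → d x x x ≈ x)

  record IsSMBOver (θ : Congruence) : Set (c ⊔ ℓ) where
    open Congruence θ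
    field
      idempotent   : IsIdempotent
      -- (i) (A/θ ; ∧) is a semilattice (equations in A/θ, i.e. modulo ∼)
      quot-idem    : ∀ x → (x ∧ x) ∼ x
      quot-comm    : ∀ x y → (x ∧ y) ∼ (y ∧ x)
      quot-assoc   : ∀ x y z → ((x ∧ y) ∧ z) ∼ (x ∧ (y ∧ z))
      class-proj₂  : ∀ {x y} → x ∼ y → (x ∧ y) ≈ y
      class-malcevˡ : ∀ {x y} → x ∼ y → d x y y ≈ x
      class-malcevʳ : ∀ {x y} → x ∼ y → d y y x ≈ x

  IsSMB : Set (suc (c ⊔ ℓ))
  IsSMB = Σ Congruence IsSMBOver

record Hom {c ℓ c′ ℓ′ : Level} (A : Algebra c ℓ) (B : Algebra c′ ℓ′) : Set (c ⊔ ℓ ⊔ c′ ⊔ ℓ′) where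
  private
    module A = Algebra A
    module B = Algebra B
  field
    ⟦_⟧   : A.Carrier → B.Carrier
    cong  : ∀ {x y} → x A.≈ y → ⟦ x ⟧ B.≈ ⟦ y ⟧
    ∧-hom : ∀ x y → ⟦ x A.∧ y ⟧ B.≈ (⟦ x ⟧ B.∧ ⟦ y ⟧)
    d-hom : ∀ x y z → ⟦ A.d x y z ⟧ B.≈ B.d ⟦ x ⟧ ⟦ y ⟧ ⟦ z ⟧

Surjective : {c ℓ c′ ℓ′ : Level} {A : Algebra c ℓ} {B : Algebra c′ ℓ′} → Hom A B → Set (c ⊔ c′ ⊔ ℓ′)
Surjective {A = A} {B = B} h = ∀ b → ∃ λ (a : Algebra.Carrier A) → Algebra._≈_ B (Hom.⟦_⟧ h a) b

record IsSubuniverse {c ℓ p : Level} (A : Algebra c ℓ) (P : Algebra.Carrier A → Set p) : Set (c ⊔ p) where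
  open Algebra A
  field
    ∧-closed : ∀ {x y} → P x → P y → P (x ∧ y)
    d-closed : ∀ {x y z} → P x → P y → P z → P (d x y z)

Sub : {c ℓ p : Level} (A : Algebra c ℓ) (P : Algebra.Carrier A → Set p) → IsSubuniverse A P → Algebra (c ⊔ p) ℓ
Sub A P S = record
  { Carrier = Σ Carrier P
  ; _≈_ = λ u v → proj₁ u ≈ proj₁ v
  ; isEquivalence = record { refl = refl ; sym = sym ; trans = trans }
  ; _∧_ = λ { (x , px) (y , py) → (x ∧ y) , ∧-closed px py }
  ; d = λ { (x , px) (y , py) (z , pz) → d x y z , d-closed px py pz }
  ; ∧-cong = ∧-cong
  ; d-cong = d-cong
  }
  where open Algebra A
        open IsEquivalence isEquivalence
        open IsSubuniverse S

Π : {i c ℓ : Level} (I : Set i) → (I → Algebra c ℓ) → Algebra (i ⊔ c) (i ⊔ ℓ)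
Π I A = record
  { Carrier = (j : I) → Algebra.Carrier (A j)
  ; _≈_ = λ f g → ∀ j → Algebra._≈_ (A j) (f j) (g j)
  ; isEquivalence = record
      { refl = λ j → IsEquivalence.refl (Algebra.isEquivalence (A j))
      ; sym = λ p j → IsEquivalence.sym (Algebra.isEquivalence (A j)) (p j)
      ; trans = λ p q j → IsEquivalence.trans (Algebra.isEquivalence (A j)) (p j) (q j) }
  ; _∧_ = λ f g j → Algebra._∧_ (A j) (f j) (g j)
  ; d = λ f g h j → Algebra.d (A j) (f j) (g j) (h j)
  ; ∧-cong = λ p q j → Algebra.∧-cong (A j) (p j) (q j)
  ; d-cong = λ p q r j → Algebra.d-cong (A j) (p j) (q j) (r j)
  }

{-# OPTIONS --safe #-}
module Submission where

-- Write x ∼ y when x ∧ y ≈ y and y ∧ x ≈ x. In an SMB algebra over θ this relation is θ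
-- itself, since ∧ is the second projection on θ-classes and x ∧ y θ y ∧ x in the semilattice
-- quotient. Hence every requirement on θ becomes an identity, e.g. "x ∧ y θ y ∧ x" becomes
-- (x ∧ y) ∧ (y ∧ x) ≈ y ∧ x. Conversely, in any model of the resulting finite set of
-- identities ∼ is a congruence over which the algebra is SMB. Identities are preserved by
-- surjective homomorphisms, subalgebras and products, hence so is being SMB.

open import Defs
open import Level using (Level; _⊔_)
open import Function.Base using (_∘_)
open import Data.Nat.Base using (ℕ)
open import Data.Fin.Base using (Fin; zero; suc)
open import Data.Vec.Functional using ([]; _∷_)
open import Data.Product.Base using (_×_; _,_; proj₁; proj₂)
open import Relation.Binary.Core using (Rel)
open import Relation.Binary.Bundles using (Setoid)
open import Relation.Binary.Structures using (IsEquivalence)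
import Relation.Binary.Reasoning.Setoid as SetoidReasoning

private
  variable
    c ℓ c′ ℓ′ p i : Level
    n : ℕ

setoid : Algebra c ℓ → Setoid c ℓ
setoid A = record { isEquivalence = Algebra.isEquivalence A }

infixr 7 _∧ₜ_

data Term (n : ℕ) : Set where
  var  : Fin n → Term n
  _∧ₜ_ : Term n → Term n → Term n
  dₜ   : Term n → Term n → Term n → Term n

pattern v₀ = var zero
pattern v₁ = var (suc zero)
pattern v₂ = var (suc (suc zero))
pattern v₃ = var (suc (suc (suc zero)))
pattern v₄ = var (suc (suc (suc (suc zero))))
pattern v₅ = var (suc (suc (suc (suc (suc zero)))))

module _ (A : Algebra c ℓ) where
  open Algebra A

  eval : Term n → (Fin n → Carrier) → Carrier
  eval (var k)    ρ = ρ k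
  eval (s ∧ₜ t)   ρ = eval s ρ ∧ eval t ρ
  eval (dₜ s t u) ρ = d (eval s ρ) (eval t ρ) (eval u ρ)

  eval-cong : (t : Term n) {ρ σ : Fin n → Carrier} → (∀ k → ρ k ≈ σ k) → eval t ρ ≈ eval t σ
  eval-cong (var k)    ρ≈σ = ρ≈σ k
  eval-cong (s ∧ₜ t)   ρ≈σ = ∧-cong (eval-cong s ρ≈σ) (eval-cong t ρ≈σ)
  eval-cong (dₜ s t u) ρ≈σ = d-cong (eval-cong s ρ≈σ) (eval-cong t ρ≈σ) (eval-cong u ρ≈σ)

infix 4 _⊨_≐_ _⊨_

record _⊨_≐_ (A : Algebra c ℓ) (l r : Term n) : Set (c ⊔ ℓ) where
  constructor satisfies
  field instantiate : ∀ ρ → Algebra._≈_ A (eval A l ρ) (eval A r ρ)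

open _⊨_≐_

Theory : Set₁
Theory = ∀ {n} → Term n → Term n → Set

_⊨_ : Algebra c ℓ → Theory → Set (c ⊔ ℓ)
A ⊨ Th = ∀ {n} {l r : Term n} → Th l r → A ⊨ l ≐ r

module _ {A : Algebra c ℓ} {B : Algebra c′ ℓ′} (h : Hom A B) where
  open Algebra B
  open IsEquivalence isEquivalence
  open Hom h
  open SetoidReasoning (setoid B)

  eval-hom : (t : Term n) (ρ : Fin n → Algebra.Carrier A) → eval B t (⟦_⟧ ∘ ρ) ≈ ⟦ eval A t ρ ⟧
  eval-hom (var k)    ρ = refl
  eval-hom (s ∧ₜ t)   ρ = trans (∧-cong (eval-hom s ρ) (eval-hom t ρ)) (sym (∧-hom _ _))
  eval-hom (dₜ s t u) ρ =
    trans (d-cong (eval-hom s ρ) (eval-hom t ρ) (eval-hom u ρ)) (sym (d-hom _ _ _))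

  ⊨-image : Surjective h → {l r : Term n} → A ⊨ l ≐ r → B ⊨ l ≐ r
  ⊨-image onto {l} {r} A⊨l≐r = satisfies λ σ →
    let ρ = proj₁ ∘ onto ∘ σ
        ⟦ρ⟧≈σ = proj₂ ∘ onto ∘ σ
    in begin
      eval B l σ            ≈⟨ eval-cong B l ⟦ρ⟧≈σ ⟨
      eval B l (⟦_⟧ ∘ ρ)    ≈⟨ eval-hom l ρ ⟩
      ⟦ eval A l ρ ⟧        ≈⟨ cong (instantiate A⊨l≐r ρ) ⟩
      ⟦ eval A r ρ ⟧        ≈⟨ eval-hom r ρ ⟨
      eval B r (⟦_⟧ ∘ ρ)    ≈⟨ eval-cong B r ⟦ρ⟧≈σ ⟩
      eval B r σ            ∎

module _ {A : Algebra c ℓ} {P : Algebra.Carrier A → Set p} (S : IsSubuniverse A P) where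
  open Algebra A

  eval-Sub : (t : Term n) (ρ : Fin n → Algebra.Carrier (Sub A P S)) →
             proj₁ (eval (Sub A P S) t ρ) ≈ eval A t (proj₁ ∘ ρ)
  eval-Sub (var k)    ρ = IsEquivalence.refl isEquivalence
  eval-Sub (s ∧ₜ t)   ρ = ∧-cong (eval-Sub s ρ) (eval-Sub t ρ)
  eval-Sub (dₜ s t u) ρ = d-cong (eval-Sub s ρ) (eval-Sub t ρ) (eval-Sub u ρ)

  ⊨-Sub : {l r : Term n} → A ⊨ l ≐ r → Sub A P S ⊨ l ≐ r
  ⊨-Sub {l = l} {r} A⊨l≐r = satisfies λ ρ → begin
    proj₁ (eval (Sub A P S) l ρ)  ≈⟨ eval-Sub l ρ ⟩
    eval A l (proj₁ ∘ ρ)          ≈⟨ instantiate A⊨l≐r (proj₁ ∘ ρ) ⟩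
    eval A r (proj₁ ∘ ρ)          ≈⟨ eval-Sub r ρ ⟨
    proj₁ (eval (Sub A P S) r ρ)  ∎
    where open SetoidReasoning (setoid A)

module _ {I : Set i} (A : I → Algebra c ℓ) where

  eval-Π : (t : Term n) (ρ : Fin n → Algebra.Carrier (Π I A)) (j : I) →
           Algebra._≈_ (A j) (eval (Π I A) t ρ j) (eval (A j) t (λ k → ρ k j))
  eval-Π (var k)    ρ j = IsEquivalence.refl (Algebra.isEquivalence (A j))
  eval-Π (s ∧ₜ t)   ρ j = Algebra.∧-cong (A j) (eval-Π s ρ j) (eval-Π t ρ j)
  eval-Π (dₜ s t u) ρ j = Algebra.d-cong (A j) (eval-Π s ρ j) (eval-Π t ρ j) (eval-Π u ρ j)

  ⊨-Π : {l r : Term n} → (∀ j → A j ⊨ l ≐ r) → Π I A ⊨ l ≐ r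
  ⊨-Π {l = l} {r} A⊨l≐r = satisfies λ ρ j → let open SetoidReasoning (setoid (A j)) in begin
    eval (Π I A) l ρ j           ≈⟨ eval-Π l ρ j ⟩
    eval (A j) l (λ k → ρ k j)   ≈⟨ instantiate (A⊨l≐r j) (λ k → ρ k j) ⟩
    eval (A j) r (λ k → ρ k j)   ≈⟨ eval-Π r ρ j ⟨
    eval (Π I A) r ρ j           ∎

-- A law of shape t ∧ₜ s ≐ s asserts one half of t ∼ s. The pair (v₁ ∧ₜ v₀ , v₀ ∧ₜ v₁) ranges
-- over all ∼-related pairs, as x ∼ y gives y ∧ x ≈ x and x ∧ y ≈ y; this is how conditions
-- restricted to a class become unconditional identities.
data SMBLaw : Theory where
  ∧-idem      : SMBLaw {1} (v₀ ∧ₜ v₀) v₀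
  d-idem      : SMBLaw {1} (dₜ v₀ v₀ v₀) v₀
  class-trans : SMBLaw {3} (((v₂ ∧ₜ v₁) ∧ₜ v₀) ∧ₜ (v₀ ∧ₜ v₁) ∧ₜ v₂) ((v₀ ∧ₜ v₁) ∧ₜ v₂)
  quot-comm   : SMBLaw {2} ((v₀ ∧ₜ v₁) ∧ₜ v₁ ∧ₜ v₀) (v₁ ∧ₜ v₀)
  quot-assocˡ : SMBLaw {3} (((v₀ ∧ₜ v₁) ∧ₜ v₂) ∧ₜ v₀ ∧ₜ v₁ ∧ₜ v₂) (v₀ ∧ₜ v₁ ∧ₜ v₂)
  quot-assocʳ : SMBLaw {3} ((v₀ ∧ₜ v₁ ∧ₜ v₂) ∧ₜ (v₀ ∧ₜ v₁) ∧ₜ v₂) ((v₀ ∧ₜ v₁) ∧ₜ v₂)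
  malcevˡ     : SMBLaw {2} (dₜ (v₁ ∧ₜ v₀) (v₀ ∧ₜ v₁) (v₀ ∧ₜ v₁)) (v₁ ∧ₜ v₀)
  malcevʳ     : SMBLaw {2} (dₜ (v₀ ∧ₜ v₁) (v₀ ∧ₜ v₁) (v₁ ∧ₜ v₀)) (v₁ ∧ₜ v₀)
  ∧-compat    : SMBLaw {4} (((v₁ ∧ₜ v₀) ∧ₜ v₃ ∧ₜ v₂) ∧ₜ (v₀ ∧ₜ v₁) ∧ₜ v₂ ∧ₜ v₃)
                           ((v₀ ∧ₜ v₁) ∧ₜ v₂ ∧ₜ v₃)
  d-compat    : SMBLaw {6} (dₜ (v₁ ∧ₜ v₀) (v₃ ∧ₜ v₂) (v₅ ∧ₜ v₄) ∧ₜ dₜ (v₀ ∧ₜ v₁) (v₂ ∧ₜ v₃) (v₄ ∧ₜ v₅))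
                           (dₜ (v₀ ∧ₜ v₁) (v₂ ∧ₜ v₃) (v₄ ∧ₜ v₅))

module _ {A : Algebra c ℓ} {θ : Congruence A} (smb : IsSMBOver A θ) where
  module θ = Congruence θ
  module S = IsSMBOver smb
  open IsEquivalence θ.isEquivalence

  IsSMBOver⇒⊨SMBLaw : A ⊨ SMBLaw
  IsSMBOver⇒⊨SMBLaw ∧-idem      = satisfies λ ρ → proj₁ S.idempotent (ρ zero)
  IsSMBOver⇒⊨SMBLaw d-idem      = satisfies λ ρ → proj₂ S.idempotent (ρ zero)
  IsSMBOver⇒⊨SMBLaw class-trans = satisfies λ ρ → S.class-proj₂
    (trans (S.quot-comm _ _) (trans (θ.∧-compat refl (S.quot-comm _ _)) (sym (S.quot-assoc _ _ _))))
  IsSMBOver⇒⊨SMBLaw quot-comm   = satisfies λ ρ → S.class-proj₂ (S.quot-comm _ _)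
  IsSMBOver⇒⊨SMBLaw quot-assocˡ = satisfies λ ρ → S.class-proj₂ (S.quot-assoc _ _ _)
  IsSMBOver⇒⊨SMBLaw quot-assocʳ = satisfies λ ρ → S.class-proj₂ (sym (S.quot-assoc _ _ _))
  IsSMBOver⇒⊨SMBLaw malcevˡ     = satisfies λ ρ → S.class-malcevˡ (S.quot-comm _ _)
  IsSMBOver⇒⊨SMBLaw malcevʳ     = satisfies λ ρ → S.class-malcevʳ (S.quot-comm _ _)
  IsSMBOver⇒⊨SMBLaw ∧-compat    = satisfies λ ρ →
    S.class-proj₂ (θ.∧-compat (S.quot-comm _ _) (S.quot-comm _ _))
  IsSMBOver⇒⊨SMBLaw d-compat    = satisfies λ ρ →
    S.class-proj₂ (θ.d-compat (S.quot-comm _ _) (S.quot-comm _ _) (S.quot-comm _ _))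

module _ {A : Algebra c ℓ} (laws : A ⊨ SMBLaw) where
  open Algebra A
  open IsEquivalence isEquivalence
  open SetoidReasoning (setoid A)

  law : {l r : Term n} → SMBLaw l r → (ρ : Fin n → Carrier) → eval A l ρ ≈ eval A r ρ
  law = instantiate ∘ laws

  infix 4 _∼_
  _∼_ : Rel Carrier ℓ
  x ∼ y = (x ∧ y) ≈ y × (y ∧ x) ≈ x

  ≈⇒∼ : ∀ {x y} → x ≈ y → x ∼ y
  ≈⇒∼ {x} {y} x≈y = trans (∧-cong x≈y refl) (law ∧-idem (y ∷ [])) ,
                    trans (∧-cong (sym x≈y) refl) (law ∧-idem (x ∷ []))

  ∼-sym : ∀ {x y} → x ∼ y → y ∼ x
  ∼-sym (xy , yx) = yx , xy

  ∼-trans-half : ∀ {x y z} → x ∼ y → y ∼ z → (x ∧ z) ≈ z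
  ∼-trans-half {x} {y} {z} (xy , yx) (yz , zy) = begin
    x ∧ z                                ≈⟨ ∧-cong x≈zy∧x z≈xy∧z ⟩
    ((z ∧ y) ∧ x) ∧ ((x ∧ y) ∧ z)        ≈⟨ law class-trans (x ∷ y ∷ z ∷ []) ⟩
    (x ∧ y) ∧ z                          ≈⟨ z≈xy∧z ⟨
    z                                    ∎
    where
    x≈zy∧x : x ≈ (z ∧ y) ∧ x
    x≈zy∧x = sym (trans (∧-cong zy refl) yx)
    z≈xy∧z : z ≈ (x ∧ y) ∧ z
    z≈xy∧z = sym (trans (∧-cong xy refl) yz)

  ∼-trans : ∀ {x y z} → x ∼ y → y ∼ z → x ∼ z
  ∼-trans x∼y y∼z = ∼-trans-half x∼y y∼z , ∼-trans-half (∼-sym y∼z) (∼-sym x∼y)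

  ∧-compat-half : ∀ {x x′ y y′} → x ∼ x′ → y ∼ y′ → ((x ∧ y) ∧ (x′ ∧ y′)) ≈ (x′ ∧ y′)
  ∧-compat-half {x} {x′} {y} {y′} (xx′ , x′x) (yy′ , y′y) = begin
    (x ∧ y) ∧ (x′ ∧ y′)                                ≈⟨ ∧-cong (∧-cong x′x y′y) (∧-cong xx′ yy′) ⟨
    ((x′ ∧ x) ∧ (y′ ∧ y)) ∧ ((x ∧ x′) ∧ (y ∧ y′))      ≈⟨ law ∧-compat (x ∷ x′ ∷ y ∷ y′ ∷ []) ⟩
    (x ∧ x′) ∧ (y ∧ y′)                                ≈⟨ ∧-cong xx′ yy′ ⟩
    x′ ∧ y′                                            ∎

  d-compat-half : ∀ {x x′ y y′ z z′} → x ∼ x′ → y ∼ y′ → z ∼ z′ →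
                  (d x y z ∧ d x′ y′ z′) ≈ d x′ y′ z′
  d-compat-half {x} {x′} {y} {y′} {z} {z′} (xx′ , x′x) (yy′ , y′y) (zz′ , z′z) = begin
    d x y z ∧ d x′ y′ z′                                    ≈⟨ ∧-cong (d-cong x′x y′y z′z) d′≈ ⟨
    d (x′ ∧ x) (y′ ∧ y) (z′ ∧ z) ∧ d (x ∧ x′) (y ∧ y′) (z ∧ z′)
      ≈⟨ law d-compat (x ∷ x′ ∷ y ∷ y′ ∷ z ∷ z′ ∷ []) ⟩
    d (x ∧ x′) (y ∧ y′) (z ∧ z′)                            ≈⟨ d′≈ ⟩
    d x′ y′ z′                                              ∎
    where
    d′≈ : d (x ∧ x′) (y ∧ y′) (z ∧ z′) ≈ d x′ y′ z′
    d′≈ = d-cong xx′ yy′ zz′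

  ∼-congruence : Congruence A
  ∼-congruence = record
    { _∼_           = _∼_
    ; isEquivalence = record { refl = ≈⇒∼ refl ; sym = ∼-sym ; trans = ∼-trans }
    ; ≈⇒∼           = ≈⇒∼
    ; ∧-compat      = λ x∼x′ y∼y′ →
        ∧-compat-half x∼x′ y∼y′ , ∧-compat-half (∼-sym x∼x′) (∼-sym y∼y′)
    ; d-compat      = λ x∼x′ y∼y′ z∼z′ →
        d-compat-half x∼x′ y∼y′ z∼z′ , d-compat-half (∼-sym x∼x′) (∼-sym y∼y′) (∼-sym z∼z′)
    }

  ⊨SMBLaw⇒IsSMBOver∼ : IsSMBOver A ∼-congruence
  ⊨SMBLaw⇒IsSMBOver∼ = record
    { idempotent    = (λ x → law ∧-idem (x ∷ [])) , (λ x → law d-idem (x ∷ []))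
    ; quot-idem     = λ x → ≈⇒∼ (law ∧-idem (x ∷ []))
    ; quot-comm     = λ x y → law quot-comm (x ∷ y ∷ []) , law quot-comm (y ∷ x ∷ [])
    ; quot-assoc    = λ x y z → law quot-assocˡ (x ∷ y ∷ z ∷ []) , law quot-assocʳ (x ∷ y ∷ z ∷ [])
    ; class-proj₂   = proj₁
    ; class-malcevˡ = λ {x} {y} (xy , yx) → begin
        d x y y                          ≈⟨ d-cong yx xy xy ⟨
        d (y ∧ x) (x ∧ y) (x ∧ y)        ≈⟨ law malcevˡ (x ∷ y ∷ []) ⟩
        y ∧ x                            ≈⟨ yx ⟩
        x                                ∎
    ; class-malcevʳ = λ {x} {y} (xy , yx) → begin
        d y y x                          ≈⟨ d-cong xy xy yx ⟨
        d (x ∧ y) (x ∧ y) (y ∧ x)        ≈⟨ law malcevʳ (x ∷ y ∷ []) ⟩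
        y ∧ x                            ≈⟨ yx ⟩
        x                                ∎
    }

  ⊨SMBLaw⇒IsSMB : IsSMB A
  ⊨SMBLaw⇒IsSMB = ∼-congruence , ⊨SMBLaw⇒IsSMBOver∼

theorem4p3 : {c ℓ c′ ℓ′ p i : Level} →
    -- closed under homomorphic images
    ((A : Algebra c ℓ) (B : Algebra c′ ℓ′) (h : Hom A B) → Surjective h →
      IsSMB A → IsSMB B)
    × -- closed under subalgebras
    ((A : Algebra c ℓ) (P : Algebra.Carrier A → Set p) (S : IsSubuniverse A P) →
      IsSMB A → IsSMB (Sub A P S))
    × -- closed under direct products
    ((I : Set i) (A : I → Algebra c ℓ) →
      ((j : I) → IsSMB (A j)) → IsSMB (Π I A))
theorem4p3 =
    (λ A B h onto (_ , smb) →
      ⊨SMBLaw⇒IsSMB (⊨-image h onto ∘ IsSMBOver⇒⊨SMBLaw smb))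
  , (λ A P S (_ , smb) →
      ⊨SMBLaw⇒IsSMB (⊨-Sub S ∘ IsSMBOver⇒⊨SMBLaw smb))
  , (λ I A smb →
      ⊨SMBLaw⇒IsSMB (λ ax → ⊨-Π A (λ j → IsSMBOver⇒⊨SMBLaw (proj₂ (smb j)) ax)))
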